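{- Let $K$ be a field, $\mathfrak{R}=K[x_0,\dots,x_n]$, and $H\subset\mathfrak{R}$ a finite set of polynomials. Define $\mathcal{V}_{SmallGen}:2^H\to2^H$ by $\mathcal{V}_{SmallGen}(S)=\{f\in H:\langle S,f\rangle\supsetneq\langle S\rangle\}$, i.e. the set of $f\in H$ with $f\notin\langle S\rangle$. Then $(H,\mathcal{V}_{SmallGen})$ is a violator space.
   Context: $\langle S\rangle$ denotes the ideal of $\mathfrak{R}$ generated by $S$. A violator space is a pair $(H,V)$ with $H$ a finite set and $V:2^H\to2^H$ a map such that (Consistency) $G\cap V(G)=\emptyset$ for all $G\subseteq H$, and (Locality) $V(G)=V(F)$ for all $F\subseteq G\subseteq H$ with $G\cap V(F)=\emptyset$. -}

module Defs where

open import Level using (Level; _⊔_; Lift) renaming (suc to lsuc)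
open import Algebra.Bundles using (CommutativeRing)
open import Data.Nat using (ℕ; zero; suc)
open import Data.Fin using (Fin)
open import Data.List using (List; []; _∷_; map; foldr)
open import Data.List.Relation.Unary.All using (All)
open import Data.Product using (_×_; _,_; ∃-syntax)
open import Relation.Nullary using (¬_)
open import Relation.Unary using (Pred; Empty; _∩_; _⊆_; _≐_)

record Field (c ℓ : Level) : Set (lsuc (c ⊔ ℓ)) where
  field
    commutativeRing : CommutativeRing c ℓ
  open CommutativeRing commutativeRing public
  field
    0≉1     : ¬ (0# ≈ 1#)
    inverse : ∀ x → ¬ (x ≈ 0#) → ∃[ y ] (x * y ≈ 1#)

-- Poly 0 = R, Poly (suc k) = (Poly k)[y] represented by coefficient
-- lists (lowest degree first).  So Poly k ≅ R[x_0, …, x_{k-1}], and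
-- K[x_0,…,x_n] is Poly (suc n).  Equality ≈P is "difference is the zero
-- polynomial" (all coefficients ≈ 0, trailing zeros allowed).

module Polynomials {c ℓ} (R : CommutativeRing c ℓ) where
  open CommutativeRing R

  Poly : ℕ → Set c
  Poly zero    = Carrier
  Poly (suc k) = List (Poly k)

  0P : ∀ k → Poly k
  0P zero    = 0#
  0P (suc k) = []

  infixl 6 _⊕_
  infixl 7 _⊗_

  _⊕_ : ∀ {k} → Poly k → Poly k → Poly k
  _⊕_ {zero}  a       b       = a + b
  _⊕_ {suc k} []      q       = q
  _⊕_ {suc k} (a ∷ p) []      = a ∷ p
  _⊕_ {suc k} (a ∷ p) (b ∷ q) = _⊕_ {k} a b ∷ _⊕_ {suc k} p q

  ⊝_ : ∀ {k} → Poly k → Poly k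
  ⊝_ {zero}  a = - a
  ⊝_ {suc k} p = map (⊝_ {k}) p

  _⊗_ : ∀ {k} → Poly k → Poly k → Poly k
  _⊗_ {zero}  a       b = a * b
  _⊗_ {suc k} []      q = []
  _⊗_ {suc k} (a ∷ p) q = _⊕_ {suc k} (map (_⊗_ {k} a) q) (0P k ∷ _⊗_ {suc k} p q)

  IsZero : ∀ {k} → Poly k → Set (c ⊔ ℓ)
  IsZero {zero}  a = Lift c (a ≈ 0#)
  IsZero {suc k} p = All (IsZero {k}) p

  infix 4 _≈P_
  _≈P_ : ∀ {k} → Poly k → Poly k → Set (c ⊔ ℓ)
  _≈P_ {k} p q = IsZero {k} (_⊕_ {k} p (⊝_ {k} q))

  -- Ideals generated by subsets of a finite indexed set of polynomials
  -- H = {h i | i : Fin m}.  A subset S ⊆ H is a predicate on indices.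
  module Generated {k m : ℕ} (h : Fin m → Poly k) where

    combination : List (Fin m × Poly k) → Poly k
    combination = foldr (λ { (i , g) acc → _⊕_ {k} (_⊗_ {k} g (h i)) acc }) (0P k)

    _∈⟨_⟩ : ∀ {a} → Poly k → Pred (Fin m) a → Set (c ⊔ ℓ ⊔ a)
    f ∈⟨ S ⟩ = ∃[ cs ] (All (λ { (i , g) → S i }) cs × _≈P_ {k} f (combination cs))

    V-SmallGen : Pred (Fin m) (c ⊔ ℓ) → Pred (Fin m) (c ⊔ ℓ)
    V-SmallGen S i = ¬ (h i ∈⟨ S ⟩)

record IsViolatorSpace {m : ℕ} {a : Level}
         (V : Pred (Fin m) a → Pred (Fin m) a) : Set (lsuc a) where
  field
    consistency : ∀ (G : Pred (Fin m) a) → Empty (G ∩ V G)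
    locality    : ∀ (F G : Pred (Fin m) a) → F ⊆ G → Empty (G ∩ V F) → V G ≐ V F

module Submission where

-- Consistency says S ⊆ ⟨S⟩.  For locality, let F ⊆ G with G ∩ 𝒱(F) = ∅.
-- Then ⟨F⟩ ⊆ ⟨G⟩ gives 𝒱(G) ⊆ 𝒱(F); conversely every generator of G lies
-- in ⟨F⟩, so the ideal ⟨G⟩ lies in ⟨F⟩ and 𝒱(F) ⊆ 𝒱(G).  Constructively
-- "G ∩ 𝒱(F) = ∅" only says each generator is not-not in ⟨F⟩, which is
-- still enough, since the goal is itself a negation.
--
-- Then Eq is shown to agree with the equality ≈P used in the
-- statement, after which ⟨S⟩ is an ideal and the argument above goes
-- through for any commutative ring of coefficients.

open import Defs
open import Level using (_⊔_; lift)
open import Algebra.Bundles using (CommutativeRing; Ring; AbelianGroup)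
open import Algebra.Structures using (IsRing; IsAbelianGroup)
open import Data.Nat using (ℕ; zero; suc)
open import Data.Fin using (Fin)
open import Data.List using (List; []; _∷_; map; _++_)
open import Data.List.Relation.Unary.All using (All; []; _∷_)
import Data.List.Relation.Unary.All as All
open import Data.List.Relation.Unary.All.Properties using (++⁺; map⁺)
open import Data.Product using (_×_; _,_; proj₁)
open import Relation.Nullary using (¬_)
open import Relation.Unary using (Pred; _⊆_)
open import Relation.Binary.PropositionalEquality using (_≡_)

module PolynomialRing {c ℓ} (R : CommutativeRing c ℓ) where
  open Polynomials R

  coeff : ∀ k → Poly (suc k) → ℕ → Poly k
  coeff k []      _       = 0P k
  coeff k (a ∷ p) zero    = a
  coeff k (a ∷ p) (suc i) = coeff k p i

  mutual
    -- The record
    -- wrapper keeps the compared polynomials inferable from the type.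
    Eq : ∀ k → Poly k → Poly k → Set ℓ
    Eq zero    a b = CommutativeRing._≈_ R a b
    Eq (suc k) p q = CoeffEq k p q

    record CoeffEq (k : ℕ) (p q : Poly (suc k)) : Set ℓ where
      inductive
      constructor coeffwise
      field at : ∀ i → Eq k (coeff k p i) (coeff k q i)

  open CoeffEq

  1P : ∀ k → Poly k
  1P zero    = CommutativeRing.1# R
  1P (suc k) = 1P k ∷ []

  IsPolyRing : ℕ → Set (c ⊔ ℓ)
  IsPolyRing k = IsRing (Eq k) (_⊕_ {k}) (_⊗_ {k}) (⊝_ {k}) (0P k) (1P k)

  asRing : ∀ k → IsPolyRing k → Ring c ℓ
  asRing k isRing = record { isRing = isRing }

  module Step (k : ℕ) (coefficientRing : IsPolyRing k) where
    open Ring (asRing k coefficientRing) hiding (zero)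

    Pol : Set c
    Pol = List Carrier

    infix  4 _≋_
    infixl 6 _⊞_
    infixl 7 _⊠_ _∙_

    _≋_ : Pol → Pol → Set ℓ
    _≋_ = Eq (suc k)

    _⊞_ : Pol → Pol → Pol
    _⊞_ = _⊕_ {suc k}

    ⊟_ : Pol → Pol
    ⊟_ = ⊝_ {suc k}

    _⊠_ : Pol → Pol → Pol
    _⊠_ = _⊗_ {suc k}

    _∙_ : Carrier → Pol → Pol
    a ∙ q = map (a *_) q

    module ByCoefficients where
      open import Relation.Binary.Reasoning.Setoid setoid

      coeff-⊞ : ∀ p q i → coeff k (p ⊞ q) i ≈ coeff k p i + coeff k q i
      coeff-⊞ []      q       i       = sym (+-identityˡ _)
      coeff-⊞ (a ∷ p) []      i       = sym (+-identityʳ _)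
      coeff-⊞ (a ∷ p) (b ∷ q) zero    = refl
      coeff-⊞ (a ∷ p) (b ∷ q) (suc i) = coeff-⊞ p q i

      coeff-map : ∀ (f : Carrier → Carrier) → f 0# ≈ 0# →
                  ∀ q i → coeff k (map f q) i ≈ f (coeff k q i)
      coeff-map f f0≈0 []      i       = sym f0≈0
      coeff-map f f0≈0 (a ∷ q) zero    = refl
      coeff-map f f0≈0 (a ∷ q) (suc i) = coeff-map f f0≈0 q i

      coeff-⊟ : ∀ p i → coeff k (⊟ p) i ≈ - coeff k p i
      coeff-⊟ = coeff-map -_ -0#≈0#
        where open import Algebra.Properties.Ring (asRing k coefficientRing) using (-0#≈0#)

      coeff-∙ : ∀ a q i → coeff k (a ∙ q) i ≈ a * coeff k q i
      coeff-∙ a = coeff-map (a *_) (zeroʳ a)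

      ≋-refl : ∀ {p} → p ≋ p
      ≋-refl = coeffwise λ i → refl

      ≋-sym : ∀ {p q} → p ≋ q → q ≋ p
      ≋-sym p≋q = coeffwise λ i → sym (at p≋q i)

      ≋-trans : ∀ {p q r} → p ≋ q → q ≋ r → p ≋ r
      ≋-trans p≋q q≋r = coeffwise λ i → trans (at p≋q i) (at q≋r i)

      ⊞-cong : ∀ {p p′ q q′} → p ≋ p′ → q ≋ q′ → p ⊞ q ≋ p′ ⊞ q′
      ⊞-cong {p} {p′} {q} {q′} p≋p′ q≋q′ = coeffwise λ i → begin
        coeff k (p ⊞ q) i            ≈⟨ coeff-⊞ p q i ⟩
        coeff k p i + coeff k q i    ≈⟨ +-cong (at p≋p′ i) (at q≋q′ i) ⟩
        coeff k p′ i + coeff k q′ i  ≈⟨ coeff-⊞ p′ q′ i ⟨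
        coeff k (p′ ⊞ q′) i          ∎

      ⊞-assoc : ∀ p q r → (p ⊞ q) ⊞ r ≋ p ⊞ (q ⊞ r)
      ⊞-assoc p q r = coeffwise λ i → begin
        coeff k ((p ⊞ q) ⊞ r) i                    ≈⟨ coeff-⊞ (p ⊞ q) r i ⟩
        coeff k (p ⊞ q) i + coeff k r i            ≈⟨ +-congʳ (coeff-⊞ p q i) ⟩
        coeff k p i + coeff k q i + coeff k r i    ≈⟨ +-assoc _ _ _ ⟩
        coeff k p i + (coeff k q i + coeff k r i)  ≈⟨ +-congˡ (coeff-⊞ q r i) ⟨
        coeff k p i + coeff k (q ⊞ r) i            ≈⟨ coeff-⊞ p (q ⊞ r) i ⟨
        coeff k (p ⊞ (q ⊞ r)) i                    ∎

      ⊞-comm : ∀ p q → p ⊞ q ≋ q ⊞ p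
      ⊞-comm p q = coeffwise λ i → begin
        coeff k (p ⊞ q) i          ≈⟨ coeff-⊞ p q i ⟩
        coeff k p i + coeff k q i  ≈⟨ +-comm _ _ ⟩
        coeff k q i + coeff k p i  ≈⟨ coeff-⊞ q p i ⟨
        coeff k (q ⊞ p) i          ∎

      ⊞-identityʳ : ∀ p → p ⊞ [] ≋ p
      ⊞-identityʳ p = coeffwise λ i → trans (coeff-⊞ p [] i) (+-identityʳ _)

      ⊟-cong : ∀ {p q} → p ≋ q → ⊟ p ≋ ⊟ q
      ⊟-cong {p} {q} p≋q = coeffwise λ i → begin
        coeff k (⊟ p) i  ≈⟨ coeff-⊟ p i ⟩
        - coeff k p i    ≈⟨ -‿cong (at p≋q i) ⟩
        - coeff k q i    ≈⟨ coeff-⊟ q i ⟨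
        coeff k (⊟ q) i  ∎

      ⊞-inverseʳ : ∀ p → p ⊞ ⊟ p ≋ []
      ⊞-inverseʳ p = coeffwise λ i → begin
        coeff k (p ⊞ ⊟ p) i            ≈⟨ coeff-⊞ p (⊟ p) i ⟩
        coeff k p i + coeff k (⊟ p) i  ≈⟨ +-congˡ (coeff-⊟ p i) ⟩
        coeff k p i - coeff k p i      ≈⟨ -‿inverseʳ _ ⟩
        0#                             ∎

      ∙-cong : ∀ {a b p q} → a ≈ b → p ≋ q → a ∙ p ≋ b ∙ q
      ∙-cong {a} {b} {p} {q} a≈b p≋q = coeffwise λ i → begin
        coeff k (a ∙ p) i  ≈⟨ coeff-∙ a p i ⟩
        a * coeff k p i    ≈⟨ *-cong a≈b (at p≋q i) ⟩
        b * coeff k q i    ≈⟨ coeff-∙ b q i ⟨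
        coeff k (b ∙ q) i  ∎

      ∙-zero : ∀ {a} q → a ≈ 0# → a ∙ q ≋ []
      ∙-zero {a} q a≈0 = coeffwise λ i → begin
        coeff k (a ∙ q) i  ≈⟨ coeff-∙ a q i ⟩
        a * coeff k q i    ≈⟨ *-congʳ a≈0 ⟩
        0# * coeff k q i   ≈⟨ zeroˡ _ ⟩
        0#                 ∎

      ∙-identity : ∀ q → 1# ∙ q ≋ q
      ∙-identity q = coeffwise λ i → trans (coeff-∙ 1# q i) (*-identityˡ _)

      ∙-assoc : ∀ a b q → (a * b) ∙ q ≋ a ∙ (b ∙ q)
      ∙-assoc a b q = coeffwise λ i → begin
        coeff k ((a * b) ∙ q) i  ≈⟨ coeff-∙ (a * b) q i ⟩
        a * b * coeff k q i      ≈⟨ *-assoc _ _ _ ⟩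
        a * (b * coeff k q i)    ≈⟨ *-congˡ (coeff-∙ b q i) ⟨
        a * coeff k (b ∙ q) i    ≈⟨ coeff-∙ a (b ∙ q) i ⟨
        coeff k (a ∙ (b ∙ q)) i  ∎

      ∙-distribˡ : ∀ a p q → a ∙ (p ⊞ q) ≋ a ∙ p ⊞ a ∙ q
      ∙-distribˡ a p q = coeffwise λ i → begin
        coeff k (a ∙ (p ⊞ q)) i                ≈⟨ coeff-∙ a (p ⊞ q) i ⟩
        a * coeff k (p ⊞ q) i                  ≈⟨ *-congˡ (coeff-⊞ p q i) ⟩
        a * (coeff k p i + coeff k q i)        ≈⟨ distribˡ _ _ _ ⟩
        a * coeff k p i + a * coeff k q i      ≈⟨ +-cong (coeff-∙ a p i) (coeff-∙ a q i) ⟨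
        coeff k (a ∙ p) i + coeff k (a ∙ q) i  ≈⟨ coeff-⊞ (a ∙ p) (a ∙ q) i ⟨
        coeff k (a ∙ p ⊞ a ∙ q) i              ∎

      ∙-distribʳ : ∀ a b q → (a + b) ∙ q ≋ a ∙ q ⊞ b ∙ q
      ∙-distribʳ a b q = coeffwise λ i → begin
        coeff k ((a + b) ∙ q) i                ≈⟨ coeff-∙ (a + b) q i ⟩
        (a + b) * coeff k q i                  ≈⟨ distribʳ _ _ _ ⟩
        a * coeff k q i + b * coeff k q i      ≈⟨ +-cong (coeff-∙ a q i) (coeff-∙ b q i) ⟨
        coeff k (a ∙ q) i + coeff k (b ∙ q) i  ≈⟨ coeff-⊞ (a ∙ q) (b ∙ q) i ⟨
        coeff k (a ∙ q ⊞ b ∙ q) i              ∎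

      ∷-cong : ∀ {a b p q} → a ≈ b → p ≋ q → a ∷ p ≋ b ∷ q
      ∷-cong a≈b p≋q = coeffwise λ where
        zero    → a≈b
        (suc i) → at p≋q i

      ∷-≋[] : ∀ {a p} → a ≈ 0# → p ≋ [] → a ∷ p ≋ []
      ∷-≋[] a≈0 p≋[] = coeffwise λ where
        zero    → a≈0
        (suc i) → at p≋[] i

      ∷-cong⁻ : ∀ {a b p q} → a ∷ p ≋ b ∷ q → a ≈ b × p ≋ q
      ∷-cong⁻ e = at e zero , coeffwise λ i → at e (suc i)

      ∷-≋[]⁻ : ∀ {a p} → a ∷ p ≋ [] → a ≈ 0# × p ≋ []
      ∷-≋[]⁻ e = at e zero , coeffwise λ i → at e (suc i)

    open ByCoefficients

    ⊞-isAbelianGroup : IsAbelianGroup _≋_ _⊞_ [] ⊟_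
    ⊞-isAbelianGroup = record
      { isGroup = record
        { isMonoid = record
          { isSemigroup = record
            { isMagma = record
              { isEquivalence = record { refl = ≋-refl ; sym = ≋-sym ; trans = ≋-trans }
              ; ∙-cong        = ⊞-cong
              }
            ; assoc = ⊞-assoc
            }
          ; identity = (λ p → ≋-refl) , ⊞-identityʳ
          }
        ; inverse = (λ p → ≋-trans (⊞-comm (⊟ p) p) (⊞-inverseʳ p)) , ⊞-inverseʳ
        ; ⁻¹-cong = ⊟-cong
        }
      ; comm = ⊞-comm
      }

    ⊞-abelianGroup : AbelianGroup c ℓ
    ⊞-abelianGroup = record { isAbelianGroup = ⊞-isAbelianGroup }

    open import Relation.Binary.Reasoning.Setoid (AbelianGroup.setoid ⊞-abelianGroup)
    open import Algebra.Properties.CommutativeSemigroup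
      (AbelianGroup.commutativeSemigroup ⊞-abelianGroup) using (interchange)

    ⊠-zero : ∀ p q → p ≋ [] → p ⊠ q ≋ []
    ⊠-zero []      q p≋[] = ≋-refl
    ⊠-zero (a ∷ p) q a∷p≋[] with ∷-≋[]⁻ a∷p≋[]
    ... | a≈0 , p≋[] = ⊞-cong (∙-zero q a≈0) (∷-≋[] refl (⊠-zero p q p≋[]))

    ⊠-congˡ : ∀ p p′ q → p ≋ p′ → p ⊠ q ≋ p′ ⊠ q
    ⊠-congˡ []      []        q p≋p′ = ≋-refl
    ⊠-congˡ []      (a′ ∷ p′) q p≋p′ = ≋-sym (⊠-zero (a′ ∷ p′) q (≋-sym p≋p′))
    ⊠-congˡ (a ∷ p) []        q p≋p′ = ⊠-zero (a ∷ p) q p≋p′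
    ⊠-congˡ (a ∷ p) (a′ ∷ p′) q a∷p≋a′∷p′ with ∷-cong⁻ a∷p≋a′∷p′
    ... | a≈a′ , p≋p′ = ⊞-cong (∙-cong a≈a′ (≋-refl {q})) (∷-cong refl (⊠-congˡ p p′ q p≋p′))

    ⊠-congʳ : ∀ p q q′ → q ≋ q′ → p ⊠ q ≋ p ⊠ q′
    ⊠-congʳ []      q q′ q≋q′ = ≋-refl
    ⊠-congʳ (a ∷ p) q q′ q≋q′ = ⊞-cong (∙-cong refl q≋q′) (∷-cong refl (⊠-congʳ p q q′ q≋q′))

    ⊠-cong : ∀ {p p′ q q′} → p ≋ p′ → q ≋ q′ → p ⊠ q ≋ p′ ⊠ q′
    ⊠-cong {p} {p′} {q} {q′} p≋p′ q≋q′ = ≋-trans (⊠-congˡ p p′ q p≋p′) (⊠-congʳ p′ q q′ q≋q′)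

    ⊠-distribʳ : ∀ q p p′ → (p ⊞ p′) ⊠ q ≋ p ⊠ q ⊞ p′ ⊠ q
    ⊠-distribʳ q []      p′       = ≋-refl
    ⊠-distribʳ q (a ∷ p) []       = ≋-sym (⊞-identityʳ _)
    ⊠-distribʳ q (a ∷ p) (b ∷ p′) = begin
      (a + b) ∙ q ⊞ (0# ∷ (p ⊞ p′) ⊠ q)
        ≈⟨ ⊞-cong (∙-distribʳ a b q) (∷-cong (sym (+-identityˡ 0#)) (⊠-distribʳ q p p′)) ⟩
      (a ∙ q ⊞ b ∙ q) ⊞ ((0# ∷ p ⊠ q) ⊞ (0# ∷ p′ ⊠ q))
        ≈⟨ interchange (a ∙ q) (b ∙ q) (0# ∷ p ⊠ q) (0# ∷ p′ ⊠ q) ⟩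
      (a ∙ q ⊞ (0# ∷ p ⊠ q)) ⊞ (b ∙ q ⊞ (0# ∷ p′ ⊠ q))
        ∎

    ⊠-distribˡ : ∀ p q q′ → p ⊠ (q ⊞ q′) ≋ p ⊠ q ⊞ p ⊠ q′
    ⊠-distribˡ []      q q′ = ≋-refl
    ⊠-distribˡ (a ∷ p) q q′ = begin
      a ∙ (q ⊞ q′) ⊞ (0# ∷ p ⊠ (q ⊞ q′))
        ≈⟨ ⊞-cong (∙-distribˡ a q q′) (∷-cong (sym (+-identityˡ 0#)) (⊠-distribˡ p q q′)) ⟩
      (a ∙ q ⊞ a ∙ q′) ⊞ ((0# ∷ p ⊠ q) ⊞ (0# ∷ p ⊠ q′))
        ≈⟨ interchange (a ∙ q) (a ∙ q′) (0# ∷ p ⊠ q) (0# ∷ p ⊠ q′) ⟩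
      (a ∙ q ⊞ (0# ∷ p ⊠ q)) ⊞ (a ∙ q′ ⊞ (0# ∷ p ⊠ q′))
        ∎

    0∷-⊠ : ∀ s r → (0# ∷ s) ⊠ r ≋ 0# ∷ s ⊠ r
    0∷-⊠ s r = ⊞-cong (∙-zero r refl) ≋-refl

    ∙-0∷ : ∀ a s → a ∙ (0# ∷ s) ≋ 0# ∷ a ∙ s
    ∙-0∷ a s = ∷-cong (zeroʳ a) ≋-refl

    ∙-⊠ : ∀ a q r → (a ∙ q) ⊠ r ≋ a ∙ (q ⊠ r)
    ∙-⊠ a []      r = ≋-refl
    ∙-⊠ a (b ∷ q) r = begin
      (a * b) ∙ r ⊞ (0# ∷ (a ∙ q) ⊠ r)  ≈⟨ ⊞-cong (∙-assoc a b r) (∷-cong refl (∙-⊠ a q r)) ⟩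
      a ∙ (b ∙ r) ⊞ (0# ∷ a ∙ (q ⊠ r))  ≈⟨ ⊞-cong (≋-refl {a ∙ (b ∙ r)}) (≋-sym (∙-0∷ a (q ⊠ r))) ⟩
      a ∙ (b ∙ r) ⊞ a ∙ (0# ∷ q ⊠ r)    ≈⟨ ∙-distribˡ a (b ∙ r) (0# ∷ q ⊠ r) ⟨
      a ∙ (b ∙ r ⊞ (0# ∷ q ⊠ r))        ∎

    ⊠-assoc : ∀ p q r → (p ⊠ q) ⊠ r ≋ p ⊠ (q ⊠ r)
    ⊠-assoc []      q r = ≋-refl
    ⊠-assoc (a ∷ p) q r = begin
      (a ∙ q ⊞ (0# ∷ p ⊠ q)) ⊠ r           ≈⟨ ⊠-distribʳ r (a ∙ q) (0# ∷ p ⊠ q) ⟩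
      (a ∙ q) ⊠ r ⊞ (0# ∷ p ⊠ q) ⊠ r        ≈⟨ ⊞-cong (∙-⊠ a q r) (0∷-⊠ (p ⊠ q) r) ⟩
      a ∙ (q ⊠ r) ⊞ (0# ∷ (p ⊠ q) ⊠ r)      ≈⟨ ⊞-cong (≋-refl {a ∙ (q ⊠ r)}) (∷-cong refl (⊠-assoc p q r)) ⟩
      a ∙ (q ⊠ r) ⊞ (0# ∷ p ⊠ (q ⊠ r))      ∎

    ⊠-identityˡ : ∀ q → (1# ∷ []) ⊠ q ≋ q
    ⊠-identityˡ q = begin
      1# ∙ q ⊞ (0# ∷ [])  ≈⟨ ⊞-cong (∙-identity q) (∷-≋[] refl ≋-refl) ⟩
      q ⊞ []              ≈⟨ ⊞-identityʳ q ⟩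
      q                   ∎

    ⊠-identityʳ : ∀ p → p ⊠ (1# ∷ []) ≋ p
    ⊠-identityʳ []      = ≋-refl
    ⊠-identityʳ (a ∷ p) = ∷-cong (trans (+-identityʳ _) (*-identityʳ a)) (⊠-identityʳ p)

    isPolyRing : IsPolyRing (suc k)
    isPolyRing = record
      { +-isAbelianGroup = ⊞-isAbelianGroup
      ; *-cong           = ⊠-cong
      ; *-assoc          = ⊠-assoc
      ; *-identity       = ⊠-identityˡ , ⊠-identityʳ
      ; distrib          = ⊠-distribˡ , ⊠-distribʳ
      }

  isPolyRing : ∀ k → IsPolyRing k
  isPolyRing zero    = CommutativeRing.isRing R
  isPolyRing (suc k) = Step.isPolyRing k (isPolyRing k)

  open Step.ByCoefficients using (∷-≋[]; ∷-≋[]⁻)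

  isZero⇒≈0 : ∀ k p → IsZero {k} p → Eq k p (0P k)
  isZero⇒≈0 zero    a       (lift a≈0)     = a≈0
  isZero⇒≈0 (suc k) []      []             = IsRing.refl (isPolyRing (suc k))
  isZero⇒≈0 (suc k) (a ∷ p) (a≈0 ∷ p≈0) =
    ∷-≋[] k (isPolyRing k) (isZero⇒≈0 k a a≈0) (isZero⇒≈0 (suc k) p p≈0)

  ≈0⇒isZero : ∀ k p → Eq k p (0P k) → IsZero {k} p
  ≈0⇒isZero zero    a       a≈0   = lift a≈0
  ≈0⇒isZero (suc k) []      _     = []
  ≈0⇒isZero (suc k) (a ∷ p) a∷p≈0 with ∷-≋[]⁻ k (isPolyRing k) a∷p≈0
  ... | a≈0 , p≈0 = ≈0⇒isZero k a a≈0 ∷ ≈0⇒isZero (suc k) p p≈0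

  module _ (k : ℕ) where
    open Ring (asRing k (isPolyRing k)) using (+-group)
    open import Algebra.Properties.Group +-group using (x∙y⁻¹≈ε⇒x≈y; x≈y⇒x∙y⁻¹≈ε)

    ≈P⇒Eq : ∀ p q → _≈P_ {k} p q → Eq k p q
    ≈P⇒Eq p q p≈Pq = x∙y⁻¹≈ε⇒x≈y p q (isZero⇒≈0 k _ p≈Pq)

    Eq⇒≈P : ∀ p q → Eq k p q → _≈P_ {k} p q
    Eq⇒≈P p q p≈q = ≈0⇒isZero k _ (x≈y⇒x∙y⁻¹≈ε p≈q)

  module Ideals {k m : ℕ} (h : Fin m → Poly k) where
    open Generated {k} {m} h
    open Ring (asRing k (isPolyRing k)) hiding (zero)
    open import Relation.Binary.Reasoning.Setoid setoid

    combination-++ : ∀ cs ds → combination (cs ++ ds) ≈ combination cs + combination ds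
    combination-++ []              ds = sym (+-identityˡ _)
    combination-++ ((i , g) ∷ cs) ds = begin
      g * h i + combination (cs ++ ds)                 ≈⟨ +-congˡ (combination-++ cs ds) ⟩
      g * h i + (combination cs + combination ds)      ≈⟨ +-assoc _ _ _ ⟨
      g * h i + combination cs + combination ds        ∎

    scaleTerm : Poly k → Fin m × Poly k → Fin m × Poly k
    scaleTerm f (i , g) = i , f * g

    combination-scale : ∀ f cs → combination (map (scaleTerm f) cs) ≈ f * combination cs
    combination-scale f []              = sym (zeroʳ f)
    combination-scale f ((i , g) ∷ cs) = begin
      f * g * h i + combination (map (scaleTerm f) cs)  ≈⟨ +-cong (*-assoc f g (h i)) (combination-scale f cs) ⟩
      f * (g * h i) + f * combination cs                ≈⟨ distribˡ f _ _ ⟨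
      f * (g * h i + combination cs)                    ∎

    module _ {a} {S : Pred (Fin m) a} where
      ∈-resp-≈ : ∀ {f f′} → f ≈ f′ → f ∈⟨ S ⟩ → f′ ∈⟨ S ⟩
      ∈-resp-≈ {f} {f′} f≈f′ (cs , cs⊆S , f≈cs) =
        cs , cs⊆S , Eq⇒≈P k f′ _ (trans (sym f≈f′) (≈P⇒Eq k f _ f≈cs))

      ∈-zero : 0# ∈⟨ S ⟩
      ∈-zero = [] , [] , Eq⇒≈P k 0# 0# refl

      ∈-+ : ∀ {f g} → f ∈⟨ S ⟩ → g ∈⟨ S ⟩ → (f + g) ∈⟨ S ⟩
      ∈-+ {f} {g} (cs , cs⊆S , f≈cs) (ds , ds⊆S , g≈ds) =
        cs ++ ds , ++⁺ cs⊆S ds⊆S , Eq⇒≈P k (f + g) _ (begin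
          f + g                              ≈⟨ +-cong (≈P⇒Eq k f _ f≈cs) (≈P⇒Eq k g _ g≈ds) ⟩
          combination cs + combination ds    ≈⟨ combination-++ cs ds ⟨
          combination (cs ++ ds)             ∎)

      ∈-* : ∀ r {f} → f ∈⟨ S ⟩ → (r * f) ∈⟨ S ⟩
      ∈-* r {f} (cs , cs⊆S , f≈cs) =
        map (scaleTerm r) cs , map⁺ cs⊆S , Eq⇒≈P k (r * f) _ (begin
          r * f                              ≈⟨ *-congˡ (≈P⇒Eq k f _ f≈cs) ⟩
          r * combination cs                 ≈⟨ combination-scale r cs ⟨
          combination (map (scaleTerm r) cs) ∎)

      ∈-generator : ∀ {i} → S i → h i ∈⟨ S ⟩
      ∈-generator {i} i∈S = (i , 1#) ∷ [] , i∈S ∷ [] , Eq⇒≈P k (h i) _ (begin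
        h i             ≈⟨ *-identityˡ (h i) ⟨
        1# * h i        ≈⟨ +-identityʳ _ ⟨
        1# * h i + 0#   ∎)

    ∈-mono : ∀ {a} {S T : Pred (Fin m) a} → S ⊆ T → ∀ {f} → f ∈⟨ S ⟩ → f ∈⟨ T ⟩
    ∈-mono S⊆T (cs , cs⊆S , f≈cs) = cs , All.map S⊆T cs⊆S , f≈cs

    -- If every generator in S lies (doubly negated) in ⟨F⟩, then so does
    -- all of ⟨S⟩.  Double negation is what the violator condition
    -- "S ∩ 𝒱(F) = ∅" provides constructively.
    ∈-¬¬-closed : ∀ {a} {S F : Pred (Fin m) a} → (∀ {j} → S j → ¬ ¬ (h j ∈⟨ F ⟩)) →
                  ∀ {f} → f ∈⟨ S ⟩ → ¬ ¬ (f ∈⟨ F ⟩)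
    ∈-¬¬-closed {S = S} {F} gens⊆⟨F⟩ {f} (cs , cs⊆S , f≈cs) f∉⟨F⟩ =
      combination-closed cs cs⊆S λ cs∈⟨F⟩ →
        f∉⟨F⟩ (∈-resp-≈ (sym (≈P⇒Eq k f _ f≈cs)) cs∈⟨F⟩)
      where
      combination-closed : ∀ cs → All (λ t → S (proj₁ t)) cs → ¬ ¬ (combination cs ∈⟨ F ⟩)
      combination-closed []              []             ∉⟨F⟩ = ∉⟨F⟩ ∈-zero
      combination-closed ((j , g) ∷ cs) (j∈S ∷ cs⊆S)  ∉⟨F⟩ =
        gens⊆⟨F⟩ j∈S λ hj∈⟨F⟩ → combination-closed cs cs⊆S λ cs∈⟨F⟩ →
          ∉⟨F⟩ (∈-+ (∈-* g hj∈⟨F⟩) cs∈⟨F⟩)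

    V-SmallGen-isViolatorSpace : IsViolatorSpace V-SmallGen
    V-SmallGen-isViolatorSpace = record
      { consistency = λ G i (i∈G , hi∉⟨G⟩) → hi∉⟨G⟩ (∈-generator i∈G)
      ; locality    = λ F G F⊆G G∩𝒱F=∅ →
          (λ hi∉⟨G⟩ hi∈⟨F⟩ → hi∉⟨G⟩ (∈-mono F⊆G hi∈⟨F⟩))
        , (λ hi∉⟨F⟩ hi∈⟨G⟩ →
             ∈-¬¬-closed (λ {j} j∈G hj∉⟨F⟩ → G∩𝒱F=∅ j (j∈G , hj∉⟨F⟩)) hi∈⟨G⟩ hi∉⟨F⟩)
      }

lemma5p2 : ∀ {c ℓ} (K : Field c ℓ) (n m : ℕ)
    (h : Fin m → Polynomials.Poly (Field.commutativeRing K) (suc n)) →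
    (∀ i j → Polynomials._≈P_ (Field.commutativeRing K) {suc n} (h i) (h j) → i ≡ j) →
    IsViolatorSpace (Polynomials.Generated.V-SmallGen (Field.commutativeRing K) {suc n} {m} h)
lemma5p2 K n m h _ = PolynomialRing.Ideals.V-SmallGen-isViolatorSpace (Field.commutativeRing K) h
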